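{- For all primes $p$, all integers $m,k$ and all integers $r \geq 1$, \[ \binom{p^r m - 1}{k}(-1)^k \equiv \binom{p^{r-1}m - 1}{\lfloor k/p \rfloor}(-1)^{\lfloor k/p\rfloor} \pmod{p^r}. \]
   Context: For arbitrary integers $n,k$ the binomial coefficient is defined by $\binom{n}{k} = \lim_{z\to 0} \frac{\Gamma(z+n+1)}{\Gamma(z+k+1)\Gamma(z+n-k+1)}$, a finite integer for all $n,k\in\mathbb{Z}$ (e.g. $\binom{ -3}{ -5}=\binom{ -3}{2}=6$). $\lfloor x\rfloor$ denotes the floor function. -}

module Defs where

open import Data.Nat as ℕ using (ℕ; zero; suc)
open import Data.Bool using (true; false)
open import Data.Nat.Combinatorics using (_C_)
open import Data.Nat.Primality using (Prime; prime⇒nonZero)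
open import Data.Integer as ℤ using (ℤ; +_; -[1+_]; _-_; _*_; _^_; -1ℤ; _/ℕ_)

-- Generalized binomial coefficient on ℤ × ℤ, i.e. the value of
--   lim_{z→0} Γ(z+n+1) / (Γ(z+k+1) Γ(z+n-k+1)).
-- Explicitly:
--   n ≥ 0 :  C(n,k) for 0 ≤ k ≤ n, and 0 otherwise;
--   n < 0 :  (-1)^k C(k-n-1, k)          if k ≥ 0,
--            (-1)^(n-k) C(-k-1, n-k)     if k ≤ n,
--            0                           if n < k < 0.
-- With n = -[1+ a ] (i.e. n = -a-1) and k = -[1+ b ] (k = -b-1):
--   k ≥ 0 case: C(k+a, k) (-1)^k;  k ≤ n means b ≥ a, n-k = b-a, -k-1 = b.
binomℤ : ℤ → ℤ → ℤ
binomℤ (+ n)    (+ k)    = + (n C k)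
binomℤ (+ n)    -[1+ k ] = + 0
binomℤ -[1+ a ] (+ k)    = (-1ℤ ^ k) * + ((k ℕ.+ a) C k)
binomℤ -[1+ a ] -[1+ b ] with a ℕ.≤ᵇ b
... | true  = (-1ℤ ^ (b ℕ.∸ a)) * + (b C (b ℕ.∸ a))
... | false = + 0

signℤ : ℤ → ℤ
signℤ (+ k)    = -1ℤ ^ k
signℤ -[1+ k ] = -1ℤ ^ suc k

floorDiv : ℤ → (p : ℕ) → Prime p → ℤ
floorDiv k p pp = (k /ℕ p) {{prime⇒nonZero pp}}

infix 4 _≡_[modℤ_]
_≡_[modℤ_] : ℤ → ℤ → ℤ → Set
a ≡ b [modℤ n ] = n ∣ (a - b)
  where open import Data.Integer.Divisibility using (_∣_)

module Submission where

-- For k ≥ 0 write F N k = (-1)^k binom(N-1, k) = ∏_{j=1}^{k} (j-N)/j, so that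
-- (k+1)·F N (k+1) = (k+1-N)·F N k.  Let N = p·N′ with p^r ∣ N′.  In the product,
-- the factors with j = p·i are (p·i - p·N′)/(p·i) = (i - N′)/i and rebuild
-- F N′ ⌊k/p⌋, while the factors with p ∤ j are quotients of p-adic units that are
-- congruent modulo p^(r+1) (as p^(r+1) ∣ N).  Hence
--     F N k · D = F N′ ⌊k/p⌋ · A     with p ∤ D and A ≡ D (mod p^(r+1)),
-- and cancelling D gives F N k ≡ F N′ ⌊k/p⌋ (mod p^(r+1)): the theorem for k ≥ 0.
-- For k = -1-b < 0 the binomial vanishes unless N ≤ 0, and for N = -A it equals
-- -(-1)^A binom(b, A).  The case k ≥ 0 applied to N′ = -A yields the Lucas-type
-- congruence binom(s + c·p, p·A) ≡ binom(c, A), and (-1)^A ≡ (-1)^(p·A) by parity.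

open import Defs
open import Data.Nat as ℕ using (ℕ; zero; suc)
open import Data.Nat.Combinatorics using (_C_; nCk+nC[k+1]≡[n+1]C[k+1]; nCk≡nC[n∸k]; nC1≡n; k>n⇒nCk≡0)
import Data.Nat.Properties as ℕP
import Data.Nat.Tactic.RingSolver as ℕSolver
open import Data.Integer as ℤ using (ℤ; +_; -[1+_]; _*_; _-_; _+_; -_; 1ℤ; -1ℤ; _^_)
import Data.Integer.Properties as ℤP
open import Data.Integer.Tactic.RingSolver using (solve-∀)
open import Relation.Binary.PropositionalEquality
import Data.Nat.Divisibility as ℕD
import Data.Integer.Divisibility.Signed as ℤD
open import Data.Nat.Primality using (Prime; prime⇒irreducible; prime⇒nonZero; euclidsLemma; ¬prime[0]; ¬prime[1])
open import Data.Product using (Σ; _×_; _,_)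
open import Data.Sum using (_⊎_; inj₁; inj₂)
open import Data.Empty using (⊥-elim)
open import Data.Nat.DivMod using (m≡m%n+[m/n]*n; m%n<n)
open import Relation.Nullary using (¬_; yes; no)
open import Data.Bool using (true; false; T)

absorption : ∀ n k → suc k ℕ.* (suc n C suc k) ≡ suc n ℕ.* (n C k)
absorption n zero = trans (ℕP.+-identityʳ _) (trans (nC1≡n (suc n)) (sym (ℕP.*-identityʳ (suc n))))
absorption zero (suc k) = begin
  suc (suc k) ℕ.* (1 C suc (suc k)) ≡⟨ cong (suc (suc k) ℕ.*_) (k>n⇒nCk≡0 {1} {suc (suc k)} (ℕ.s≤s (ℕ.s≤s ℕ.z≤n))) ⟩
  suc (suc k) ℕ.* 0                 ≡⟨ ℕP.*-zeroʳ (suc (suc k)) ⟩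
  0                                 ≡⟨ cong (1 ℕ.*_) (k>n⇒nCk≡0 {0} {suc k} (ℕ.s≤s ℕ.z≤n)) ⟨
  1 ℕ.* (0 C suc k)                 ∎
  where open ≡-Reasoning
absorption (suc n) (suc k) = begin
  (2 ℕ.+ k) ℕ.* (suc (suc n) C suc (suc k))
    ≡⟨ cong ((2 ℕ.+ k) ℕ.*_) (sym (pascal (suc n) (suc k))) ⟩
  (2 ℕ.+ k) ℕ.* (u ℕ.+ v)
    ≡⟨ regroupˡ k u v ⟩
  ((1 ℕ.+ k) ℕ.* u ℕ.+ u) ℕ.+ (2 ℕ.+ k) ℕ.* v
    ≡⟨ cong₂ (λ x y → x ℕ.+ u ℕ.+ y) (absorption n k) (absorption n (suc k)) ⟩
  (1 ℕ.+ n) ℕ.* x ℕ.+ u ℕ.+ (1 ℕ.+ n) ℕ.* y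
    ≡⟨ cong (λ z → (1 ℕ.+ n) ℕ.* x ℕ.+ z ℕ.+ (1 ℕ.+ n) ℕ.* y) (sym (pascal n k)) ⟩
  (1 ℕ.+ n) ℕ.* x ℕ.+ (x ℕ.+ y) ℕ.+ (1 ℕ.+ n) ℕ.* y
    ≡⟨ regroupʳ n x y ⟩
  (2 ℕ.+ n) ℕ.* (x ℕ.+ y)
    ≡⟨ cong ((2 ℕ.+ n) ℕ.*_) (pascal n k) ⟩
  (2 ℕ.+ n) ℕ.* (suc n C suc k) ∎
  where
  open ≡-Reasoning
  pascal : ∀ n k → n C k ℕ.+ n C suc k ≡ suc n C suc k
  pascal = nCk+nC[k+1]≡[n+1]C[k+1]
  u v x y : ℕ
  u = suc n C suc k
  v = suc n C suc (suc k)
  x = n C k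
  y = n C suc k
  regroupˡ : ∀ k u v → (2 ℕ.+ k) ℕ.* (u ℕ.+ v) ≡ ((1 ℕ.+ k) ℕ.* u ℕ.+ u) ℕ.+ (2 ℕ.+ k) ℕ.* v
  regroupˡ = ℕSolver.solve-∀
  regroupʳ : ∀ n x y → (1 ℕ.+ n) ℕ.* x ℕ.+ (x ℕ.+ y) ℕ.+ (1 ℕ.+ n) ℕ.* y ≡ (2 ℕ.+ n) ℕ.* (x ℕ.+ y)
  regroupʳ = ℕSolver.solve-∀

choose-symmetric : ∀ k a → (k ℕ.+ a) C k ≡ (k ℕ.+ a) C a
choose-symmetric k a = trans (nCk≡nC[n∸k] (ℕP.m≤m+n k a)) (cong ((k ℕ.+ a) C_) (ℕP.m+n∸m≡n k a))

-1^[2n]≡1 : ∀ n → -1ℤ ^ (2 ℕ.* n) ≡ 1ℤ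
-1^[2n]≡1 n = trans (sym (ℤP.^-*-assoc -1ℤ 2 n)) (ℤP.^-zeroˡ n)

-1^n*-1^n≡1 : ∀ n → -1ℤ ^ n * -1ℤ ^ n ≡ 1ℤ
-1^n*-1^n≡1 n = begin
  -1ℤ ^ n * -1ℤ ^ n      ≡⟨ ℤP.^-distribˡ-+-* -1ℤ n n ⟨
  -1ℤ ^ (n ℕ.+ n)        ≡⟨ cong (λ m → -1ℤ ^ (n ℕ.+ m)) (ℕP.+-identityʳ n) ⟨
  -1ℤ ^ (2 ℕ.* n)        ≡⟨ -1^[2n]≡1 n ⟩
  1ℤ                     ∎
  where open ≡-Reasoning

signedBinom : ℤ → ℕ → ℤ
signedBinom N k = binomℤ (N - 1ℤ) (+ k) * signℤ (+ k)

signedBinom-zero : ∀ N → signedBinom N 0 ≡ 1ℤ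
signedBinom-zero (+ zero)  = refl
signedBinom-zero (+ suc n) = refl
signedBinom-zero -[1+ a ]  = refl

-1-a≡-[1+a] : ∀ a → - (+ a) - 1ℤ ≡ -[1+ a ]
-1-a≡-[1+a] zero    = refl
-1-a≡-[1+a] (suc a) = cong (λ b → -[1+ suc b ]) (ℕP.+-identityʳ a)

signedBinom-nonpositive : ∀ a k → signedBinom (- (+ a)) k ≡ + ((k ℕ.+ a) C k)
signedBinom-nonpositive a k = begin
  binomℤ (- (+ a) - 1ℤ) (+ k) * -1ℤ ^ k  ≡⟨ cong (λ n → binomℤ n (+ k) * -1ℤ ^ k) (-1-a≡-[1+a] a) ⟩
  -1ℤ ^ k * X * -1ℤ ^ k                  ≡⟨ regroup (-1ℤ ^ k) X ⟩
  (-1ℤ ^ k * -1ℤ ^ k) * X                ≡⟨ cong (_* X) (-1^n*-1^n≡1 k) ⟩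
  1ℤ * X                                 ≡⟨ ℤP.*-identityˡ X ⟩
  X                                      ∎
  where
  open ≡-Reasoning
  X : ℤ
  X = + ((k ℕ.+ a) C k)
  regroup : ∀ s x → s * x * s ≡ (s * s) * x
  regroup = solve-∀

signedBinom-step-positive : ∀ n k → signedBinom (+ suc n) (suc k) * + suc k ≡ signedBinom (+ suc n) k * (+ suc k - + suc n)
signedBinom-step-positive n k = begin
  X * (-1ℤ * s) * (1ℤ + K)                           ≡⟨ expand X Y K s ⟩
  s * ((1ℤ + K) * Y - ((1ℤ + K) * X + (1ℤ + K) * Y)) ≡⟨ cong (λ z → s * ((1ℤ + K) * Y - z)) absorptionℤ ⟩
  s * ((1ℤ + K) * Y - (1ℤ + + n) * Y)                ≡⟨ collect Y K (+ n) s ⟩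
  Y * s * ((1ℤ + K) - (1ℤ + + n))                    ∎
  where
  open ≡-Reasoning
  X Y K s : ℤ
  X = + (n C suc k)
  Y = + (n C k)
  K = + k
  s = -1ℤ ^ k
  expand : ∀ X Y K s → X * (-1ℤ * s) * (1ℤ + K) ≡ s * ((1ℤ + K) * Y - ((1ℤ + K) * X + (1ℤ + K) * Y))
  expand = solve-∀
  collect : ∀ Y K N s → s * ((1ℤ + K) * Y - (1ℤ + N) * Y) ≡ Y * s * ((1ℤ + K) - (1ℤ + N))
  collect = solve-∀
  absorptionℕ : suc k ℕ.* (n C suc k) ℕ.+ suc k ℕ.* (n C k) ≡ suc n ℕ.* (n C k)
  absorptionℕ = begin
    suc k ℕ.* (n C suc k) ℕ.+ suc k ℕ.* (n C k) ≡⟨ ℕP.+-comm (suc k ℕ.* (n C suc k)) _ ⟩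
    suc k ℕ.* (n C k) ℕ.+ suc k ℕ.* (n C suc k) ≡⟨ ℕP.*-distribˡ-+ (suc k) (n C k) (n C suc k) ⟨
    suc k ℕ.* (n C k ℕ.+ n C suc k)             ≡⟨ cong (suc k ℕ.*_) (nCk+nC[k+1]≡[n+1]C[k+1] n k) ⟩
    suc k ℕ.* (suc n C suc k)                   ≡⟨ absorption n k ⟩
    suc n ℕ.* (n C k)                           ∎
  absorptionℤ : (1ℤ + K) * X + (1ℤ + K) * Y ≡ (1ℤ + + n) * Y
  absorptionℤ = begin
    (1ℤ + K) * X + (1ℤ + K) * Y                       ≡⟨ cong₂ _+_ (ℤP.pos-* (suc k) (n C suc k)) (ℤP.pos-* (suc k) (n C k)) ⟨
    + (suc k ℕ.* (n C suc k)) + + (suc k ℕ.* (n C k)) ≡⟨ ℤP.pos-+ (suc k ℕ.* (n C suc k)) (suc k ℕ.* (n C k)) ⟨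
    + (suc k ℕ.* (n C suc k) ℕ.+ suc k ℕ.* (n C k))   ≡⟨ cong +_ absorptionℕ ⟩
    + (suc n ℕ.* (n C k))                             ≡⟨ ℤP.pos-* (suc n) (n C k) ⟩
    (1ℤ + + n) * Y                                    ∎

signedBinom-step-nonpositive : ∀ a k → signedBinom (- (+ a)) (suc k) * + suc k ≡ signedBinom (- (+ a)) k * (+ suc k - - (+ a))
signedBinom-step-nonpositive a k = begin
  signedBinom (- (+ a)) (suc k) * + suc k  ≡⟨ cong (_* + suc k) (signedBinom-nonpositive a (suc k)) ⟩
  + ((suc k ℕ.+ a) C suc k) * + suc k      ≡⟨ ℤP.pos-* ((suc k ℕ.+ a) C suc k) (suc k) ⟨
  + (((suc k ℕ.+ a) C suc k) ℕ.* suc k)    ≡⟨ cong +_ (ℕP.*-comm ((suc k ℕ.+ a) C suc k) (suc k)) ⟩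
  + (suc k ℕ.* ((suc k ℕ.+ a) C suc k))    ≡⟨ cong +_ (absorption (k ℕ.+ a) k) ⟩
  + (suc (k ℕ.+ a) ℕ.* ((k ℕ.+ a) C k))    ≡⟨ cong +_ (ℕP.*-comm (suc (k ℕ.+ a)) ((k ℕ.+ a) C k)) ⟩
  + (((k ℕ.+ a) C k) ℕ.* suc (k ℕ.+ a))    ≡⟨ ℤP.pos-* ((k ℕ.+ a) C k) (suc k ℕ.+ a) ⟩
  + ((k ℕ.+ a) C k) * + (suc k ℕ.+ a)      ≡⟨ cong₂ _*_ (sym (signedBinom-nonpositive a k)) (ℤP.pos-+ (suc k) a) ⟩
  signedBinom (- (+ a)) k * (+ suc k + + a) ≡⟨ cong (λ x → signedBinom (- (+ a)) k * (+ suc k + x)) (ℤP.neg-involutive (+ a)) ⟨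
  signedBinom (- (+ a)) k * (+ suc k - - (+ a)) ∎
  where open ≡-Reasoning

signedBinom-step : ∀ N k → signedBinom N (suc k) * + suc k ≡ signedBinom N k * (+ suc k - N)
signedBinom-step (+ suc n) k = signedBinom-step-positive n k
signedBinom-step (+ zero)  k = signedBinom-step-nonpositive 0 k
signedBinom-step -[1+ a ]  k = signedBinom-step-nonpositive (suc a) k

≡⇒∣- : ∀ {d a b} → a ≡ b → d ℤD.∣ a - b
≡⇒∣- {d} {a} refl = subst (d ℤD.∣_) (sym (ℤP.+-inverseʳ a)) (ℤD.divides (+ 0) refl)

parity : ∀ n → (Σ ℕ λ e → n ≡ 2 ℕ.* e) ⊎ (Σ ℕ λ e → n ≡ 1 ℕ.+ 2 ℕ.* e)
parity zero = inj₁ (0 , refl)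
parity (suc n) with parity n
... | inj₁ (e , refl) = inj₂ (e , refl)
... | inj₂ (e , refl) = inj₁ (suc e , sym (ℕP.*-suc 2 e))

odd⇒2∤ : ∀ e → ¬ (2 ℕD.∣ 1 ℕ.+ 2 ℕ.* e)
odd⇒2∤ e 2∣odd with ℕD.∣1⇒≡1 (ℕD.∣m+n∣m⇒∣n (subst (2 ℕD.∣_) (ℕP.+-comm 1 (2 ℕ.* e)) 2∣odd) (ℕD.m∣m*n e))
... | ()

prime-parity : ∀ {p} → Prime p → p ≡ 2 ⊎ (Σ ℕ λ f → p ≡ 1 ℕ.+ 2 ℕ.* f)
prime-parity {p} p-prime with parity p
... | inj₂ odd = inj₂ odd
... | inj₁ (f , p≡2f) with prime⇒irreducible p-prime (ℕD.divides f (trans p≡2f (ℕP.*-comm 2 f)))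
...   | inj₁ ()
...   | inj₂ 2≡p = inj₁ (sym 2≡p)

-1^[m+2n]≡-1^m : ∀ m n → -1ℤ ^ (m ℕ.+ 2 ℕ.* n) ≡ -1ℤ ^ m
-1^[m+2n]≡-1^m m n = begin
  -1ℤ ^ (m ℕ.+ 2 ℕ.* n)      ≡⟨ ℤP.^-distribˡ-+-* -1ℤ m (2 ℕ.* n) ⟩
  -1ℤ ^ m * -1ℤ ^ (2 ℕ.* n)  ≡⟨ cong (-1ℤ ^ m *_) (-1^[2n]≡1 n) ⟩
  -1ℤ ^ m * 1ℤ               ≡⟨ ℤP.*-identityʳ (-1ℤ ^ m) ⟩
  -1ℤ ^ m                    ∎
  where open ≡-Reasoning

-- For p = 2 the signs (-1)^a and (-1)^(2a) = 1 agree modulo 2^(r+1) when 2^r ∣ a: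
-- for odd a this forces r = 0, and -1 ≡ 1 (mod 2).
sign-congruence-two : ∀ r a → 2 ℕ.^ r ℕD.∣ a → + (2 ℕ.^ suc r) ℤD.∣ -1ℤ ^ a - -1ℤ ^ (2 ℕ.* a)
sign-congruence-two r a 2^r∣a with parity a
... | inj₁ (e , refl) = ≡⇒∣- (trans (-1^[2n]≡1 e) (sym (-1^[2n]≡1 (2 ℕ.* e))))
... | inj₂ (e , refl) with r
...   | suc r′ = ⊥-elim (odd⇒2∤ e (ℕD.∣-trans (ℕD.m∣m*n (2 ℕ.^ r′)) 2^r∣a))
...   | zero   = subst (+ 2 ℤD.∣_) (sym -1-1≡-2) (ℤD.divides -1ℤ refl)
  where
  -1-1≡-2 : -1ℤ ^ (1 ℕ.+ 2 ℕ.* e) - -1ℤ ^ (2 ℕ.* (1 ℕ.+ 2 ℕ.* e)) ≡ -1ℤ * + 2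
  -1-1≡-2 = cong₂ (λ x y → -1ℤ * x - y) (-1^[2n]≡1 e) (-1^[2n]≡1 (1 ℕ.+ 2 ℕ.* e))

-- (-1)^a ≡ (-1)^(p·a) (mod p^(r+1)) for a prime p with p^r ∣ a: for odd p the two
-- exponents have the same parity.
sign-congruence : ∀ {p} r a → Prime p → p ℕ.^ r ℕD.∣ a → + (p ℕ.^ suc r) ℤD.∣ -1ℤ ^ a - -1ℤ ^ (p ℕ.* a)
sign-congruence r a p-prime p^r∣a with prime-parity p-prime
... | inj₁ refl = sign-congruence-two r a p^r∣a
... | inj₂ (f , refl) = ≡⇒∣- (sym (trans (cong (-1ℤ ^_) (odd-multiple f a)) (-1^[m+2n]≡-1^m a (f ℕ.* a))))
  where
  odd-multiple : ∀ f a → (1 ℕ.+ 2 ℕ.* f) ℕ.* a ≡ a ℕ.+ 2 ℕ.* (f ℕ.* a)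
  odd-multiple = ℕSolver.solve-∀

signedBinom⁻ : ℤ → ℕ → ℤ
signedBinom⁻ N b = binomℤ (N - 1ℤ) -[1+ b ] * signℤ -[1+ b ]

binomℤ-negative-inside : ∀ A b → A ℕ.≤ b → binomℤ -[1+ A ] -[1+ b ] ≡ -1ℤ ^ (b ℕ.∸ A) * + (b C (b ℕ.∸ A))
binomℤ-negative-inside A b A≤b with A ℕ.≤ᵇ b in A≤ᵇb
... | true  = refl
... | false = ⊥-elim (subst T A≤ᵇb (ℕP.≤⇒≤ᵇ A≤b))

binomℤ-negative-outside : ∀ A b → b ℕ.< A → binomℤ -[1+ A ] -[1+ b ] ≡ + 0
binomℤ-negative-outside A b b<A with A ℕ.≤ᵇ b in A≤ᵇb
... | true  = ⊥-elim (ℕP.<⇒≱ b<A (ℕP.≤ᵇ⇒≤ A b (subst T (sym A≤ᵇb) _)))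
... | false = refl

-- For N = -A ≤ 0 it is -(-1)^A binom(b, A), by the reflection k ↦ n - k of the
-- upper index n = -1-A.
signedBinom⁻-nonpositive : ∀ A b → signedBinom⁻ (- (+ A)) b ≡ - (-1ℤ ^ A * + (b C A))
signedBinom⁻-nonpositive A b with A ℕ.≤? b
... | yes A≤b = begin
  binomℤ (- (+ A) - 1ℤ) -[1+ b ] * (-1ℤ * -1ℤ ^ b)
    ≡⟨ cong (λ n → binomℤ n -[1+ b ] * (-1ℤ * -1ℤ ^ b)) (-1-a≡-[1+a] A) ⟩
  binomℤ -[1+ A ] -[1+ b ] * (-1ℤ * -1ℤ ^ b)
    ≡⟨ cong₂ (λ x y → x * (-1ℤ * y)) (binomℤ-negative-inside A b A≤b) -1^b≡-1^d*-1^A ⟩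
  -1ℤ ^ d * + (b C d) * (-1ℤ * (-1ℤ ^ d * -1ℤ ^ A))
    ≡⟨ cong (λ x → -1ℤ ^ d * + x * (-1ℤ * (-1ℤ ^ d * -1ℤ ^ A))) (nCk≡nC[n∸k] A≤b) ⟨
  -1ℤ ^ d * + (b C A) * (-1ℤ * (-1ℤ ^ d * -1ℤ ^ A))
    ≡⟨ regroup (-1ℤ ^ d) (-1ℤ ^ A) (+ (b C A)) ⟩
  - ((-1ℤ ^ d * -1ℤ ^ d) * (-1ℤ ^ A * + (b C A)))
    ≡⟨ cong (λ z → - (z * (-1ℤ ^ A * + (b C A)))) (-1^n*-1^n≡1 d) ⟩
  - (1ℤ * (-1ℤ ^ A * + (b C A)))
    ≡⟨ cong -_ (ℤP.*-identityˡ _) ⟩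
  - (-1ℤ ^ A * + (b C A)) ∎
  where
  open ≡-Reasoning
  d : ℕ
  d = b ℕ.∸ A
  -1^b≡-1^d*-1^A : -1ℤ ^ b ≡ -1ℤ ^ d * -1ℤ ^ A
  -1^b≡-1^d*-1^A = trans (cong (-1ℤ ^_) (sym (ℕP.m∸n+n≡m A≤b))) (ℤP.^-distribˡ-+-* -1ℤ d A)
  regroup : ∀ s t X → s * X * (-1ℤ * (s * t)) ≡ - ((s * s) * (t * X))
  regroup = solve-∀
... | no A≰b = begin
  binomℤ (- (+ A) - 1ℤ) -[1+ b ] * (-1ℤ * -1ℤ ^ b)
    ≡⟨ cong (λ n → binomℤ n -[1+ b ] * (-1ℤ * -1ℤ ^ b)) (-1-a≡-[1+a] A) ⟩
  binomℤ -[1+ A ] -[1+ b ] * (-1ℤ * -1ℤ ^ b)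
    ≡⟨ cong (_* (-1ℤ * -1ℤ ^ b)) (binomℤ-negative-outside A b b<A) ⟩
  + 0
    ≡⟨ cong -_ (ℤP.*-zeroʳ (-1ℤ ^ A)) ⟨
  - (-1ℤ ^ A * + 0)
    ≡⟨ cong (λ x → - (-1ℤ ^ A * + x)) (k>n⇒nCk≡0 b<A) ⟨
  - (-1ℤ ^ A * + (b C A)) ∎
  where
  open ≡-Reasoning
  b<A : b ℕ.< A
  b<A = ℕP.≰⇒> A≰b

n*-A≡-nA : ∀ n A → + n * - (+ A) ≡ - (+ (n ℕ.* A))
n*-A≡-nA n A = trans (sym (ℤP.neg-distribʳ-* (+ n) (+ A))) (cong -_ (sym (ℤP.pos-* n A)))

∣-cancel-coprime : ∀ {p} → Prime p → ∀ r x D → ¬ (p ℕD.∣ D) → p ℕ.^ r ℕD.∣ x ℕ.* D → p ℕ.^ r ℕD.∣ x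
∣-cancel-coprime p-prime zero x D p∤D _ = ℕD.1∣ x
∣-cancel-coprime {p} p-prime (suc r) x D p∤D p^[1+r]∣xD
  with euclidsLemma x D p-prime (ℕD.∣-trans (ℕD.m∣m*n (p ℕ.^ r)) p^[1+r]∣xD)
... | inj₂ p∣D = ⊥-elim (p∤D p∣D)
... | inj₁ (ℕD.divides y refl) = subst (p ℕ.* p ℕ.^ r ℕD.∣_) (ℕP.*-comm p y) (ℕD.*-monoʳ-∣ p p^r∣y)
  where
  instance _ = prime⇒nonZero p-prime
  reassociate : ∀ y p D → y ℕ.* p ℕ.* D ≡ p ℕ.* (y ℕ.* D)
  reassociate = ℕSolver.solve-∀
  p^r∣yD : p ℕ.^ r ℕD.∣ y ℕ.* D
  p^r∣yD = ℕD.*-cancelˡ-∣ p (subst (p ℕ.* p ℕ.^ r ℕD.∣_) (reassociate y p D) p^[1+r]∣xD)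
  p^r∣y : p ℕ.^ r ℕD.∣ y
  p^r∣y = ∣-cancel-coprime p-prime r y D p∤D p^r∣yD

module Modulo (p₁ : ℕ) (p-prime : Prime (suc p₁)) (r : ℕ) where

  p : ℕ
  p = suc p₁

  P : ℤ
  P = + (p ℕ.^ suc r)

  Unit : ℤ → Set
  Unit D = ¬ (p ℕD.∣ ℤ.∣ D ∣)

  unit-* : ∀ {D E} → Unit D → Unit E → Unit (D * E)
  unit-* {D} {E} D-unit E-unit p∣DE with euclidsLemma ℤ.∣ D ∣ ℤ.∣ E ∣ p-prime (subst (p ℕD.∣_) (ℤP.abs-* D E) p∣DE)
  ... | inj₁ p∣D = D-unit p∣D
  ... | inj₂ p∣E = E-unit p∣E

  unit-cancel : ∀ x D → Unit D → P ℤD.∣ x * D → P ℤD.∣ x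
  unit-cancel x D D-unit P∣xD = ℤD.∣ᵤ⇒∣ (∣-cancel-coprime p-prime (suc r) ℤ.∣ x ∣ ℤ.∣ D ∣ D-unit
    (subst (p ℕ.^ suc r ℕD.∣_) (ℤP.abs-* x D) (ℤD.∣⇒∣ᵤ P∣xD)))

  module Scaling (N′ : ℤ) (p^r∣N′ : + (p ℕ.^ r) ℤD.∣ N′) where

    N : ℤ
    N = + p * N′

    -- The hypothesis that makes j - N ≡ j (mod P) for every j.
    P∣N : P ℤD.∣ N
    P∣N = subst (ℤD._∣ N) (sym (ℤP.pos-* p (p ℕ.^ r))) (ℤD.*-monoʳ-∣ (+ p) p^r∣N′)

    -- The invariant behind the congruence: F N k · D = F N′ q · A with D a unit
    -- and A ≡ D, obtained by collecting the factors (j - N)/j with p ∤ j.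
    record Factorisation (k q : ℕ) : Set where
      field
        D A      : ℤ
        D-unit   : Unit D
        A≡D      : P ℤD.∣ A - D
        equation : signedBinom N k * D ≡ signedBinom N′ q * A

    -- Passing from k to k+1 = (q+1)·p multiplies F N by (k+1-N)/(k+1) and F N′ by
    -- the same factor (q+1-N′)/(q+1), since k+1-N = p·(q+1-N′).
    extend-multiple : ∀ q → Factorisation (p₁ ℕ.+ q ℕ.* p) q → Factorisation (suc (p₁ ℕ.+ q ℕ.* p)) (suc q)
    extend-multiple q φ = record { D = D ; A = A ; D-unit = D-unit ; A≡D = A≡D
                                 ; equation = ℤP.*-cancelʳ-≡ _ _ K cancelled-equation }
      where
      open Factorisation φ
      k : ℕ
      k = p₁ ℕ.+ q ℕ.* p
      K Q : ℤ
      K = + suc k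
      Q = + suc q
      K≡Q*p : K ≡ Q * + p
      K≡Q*p = ℤP.pos-* (suc q) p
      open ≡-Reasoning
      cancelled-equation : signedBinom N (suc k) * D * K ≡ signedBinom N′ (suc q) * A * K
      cancelled-equation = begin
        signedBinom N (suc k) * D * K             ≡⟨ swap-last (signedBinom N (suc k)) D K ⟩
        signedBinom N (suc k) * K * D             ≡⟨ cong (_* D) (signedBinom-step N k) ⟩
        signedBinom N k * (K - N) * D             ≡⟨ cong (λ z → signedBinom N k * (z - N) * D) K≡Q*p ⟩
        signedBinom N k * (Q * + p - N) * D       ≡⟨ factor-p (signedBinom N k) Q (+ p) N′ D ⟩
        signedBinom N k * D * ((Q - N′) * + p)    ≡⟨ cong (_* ((Q - N′) * + p)) equation ⟩
        signedBinom N′ q * A * ((Q - N′) * + p)   ≡⟨ regroup (signedBinom N′ q) A (Q - N′) (+ p) ⟩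
        signedBinom N′ q * (Q - N′) * (A * + p)   ≡⟨ cong (_* (A * + p)) (signedBinom-step N′ q) ⟨
        signedBinom N′ (suc q) * Q * (A * + p)    ≡⟨ regroup′ (signedBinom N′ (suc q)) Q A (+ p) ⟩
        signedBinom N′ (suc q) * A * (Q * + p)    ≡⟨ cong (signedBinom N′ (suc q) * A *_) K≡Q*p ⟨
        signedBinom N′ (suc q) * A * K            ∎
        where
        swap-last : ∀ f D K → f * D * K ≡ f * K * D
        swap-last = solve-∀
        factor-p : ∀ f Q p N′ D → f * (Q * p - p * N′) * D ≡ f * D * ((Q - N′) * p)
        factor-p = solve-∀
        regroup : ∀ f A X p → f * A * (X * p) ≡ f * X * (A * p)
        regroup = solve-∀
        regroup′ : ∀ f Q A p → f * Q * (A * p) ≡ f * A * (Q * p)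
        regroup′ = solve-∀

    -- Passing from k to k+1 with p ∤ k+1 multiplies F N by (k+1-N)/(k+1), a
    -- quotient of units congruent to each other; it is absorbed into D and A.
    extend-unit : ∀ k q → Factorisation k q → ¬ (p ℕD.∣ suc k) → Factorisation (suc k) q
    extend-unit k q φ p∤k+1 = record
      { D        = D * K
      ; A        = A * (K - N)
      ; D-unit   = unit-* {D} {K} D-unit p∤k+1
      ; A≡D      = subst (P ℤD.∣_) (sym (difference A D K N))
                     (ℤD.∣m∣n⇒∣m-n (ℤD.∣n⇒∣m*n K A≡D) (ℤD.∣n⇒∣m*n A P∣N))
      ; equation = begin
          signedBinom N (suc k) * (D * K)  ≡⟨ regroup (signedBinom N (suc k)) D K ⟩
          signedBinom N (suc k) * K * D    ≡⟨ cong (_* D) (signedBinom-step N k) ⟩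
          signedBinom N k * (K - N) * D    ≡⟨ regroup′ (signedBinom N k) (K - N) D ⟩
          signedBinom N k * D * (K - N)    ≡⟨ cong (_* (K - N)) equation ⟩
          signedBinom N′ q * A * (K - N)   ≡⟨ ℤP.*-assoc (signedBinom N′ q) A (K - N) ⟩
          signedBinom N′ q * (A * (K - N)) ∎
      }
      where
      open Factorisation φ
      open ≡-Reasoning
      K : ℤ
      K = + suc k
      difference : ∀ A D K N → A * (K - N) - D * K ≡ K * (A - D) - A * N
      difference = solve-∀
      regroup : ∀ f D K → f * (D * K) ≡ f * K * D
      regroup = solve-∀
      regroup′ : ∀ f X D → f * X * D ≡ f * D * X
      regroup′ = solve-∀

    factorisation : ∀ q s → s ℕ.< p → Factorisation (s ℕ.+ q ℕ.* p) q
    factorisation zero zero _ = record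
      { D = 1ℤ ; A = 1ℤ ; D-unit = p∤1 ; A≡D = ≡⇒∣- {b = 1ℤ} refl
      ; equation = cong (_* 1ℤ) (trans (signedBinom-zero N) (sym (signedBinom-zero N′))) }
      where
      p∤1 : ¬ (p ℕD.∣ 1)
      p∤1 p∣1 = ¬prime[1] (subst Prime (ℕD.∣1⇒≡1 p∣1) p-prime)
    factorisation (suc q) zero _ = extend-multiple q (factorisation q p₁ ℕP.≤-refl)
    factorisation q (suc s) s<p =
      extend-unit (s ℕ.+ q ℕ.* p) q (factorisation q s (ℕP.<-trans (ℕP.n<1+n s) s<p)) p∤k+1
      where
      p∤k+1 : ¬ (p ℕD.∣ suc s ℕ.+ q ℕ.* p)
      p∤k+1 p∣k+1 = ℕD.>⇒∤ s<p (ℕD.∣m+n∣m⇒∣n (subst (p ℕD.∣_) (ℕP.+-comm (suc s) (q ℕ.* p)) p∣k+1) (ℕD.n∣m*n q))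

    factorisation⇒congruence : ∀ {k q} → Factorisation k q → P ℤD.∣ signedBinom N k - signedBinom N′ q
    factorisation⇒congruence {k} {q} φ = unit-cancel _ D D-unit
      (subst (P ℤD.∣_) rearranged (ℤD.∣n⇒∣m*n (signedBinom N′ q) A≡D))
      where
      open Factorisation φ
      open ≡-Reasoning
      rearranged : signedBinom N′ q * (A - D) ≡ (signedBinom N k - signedBinom N′ q) * D
      rearranged = begin
        signedBinom N′ q * (A - D)                            ≡⟨ expand (signedBinom N′ q) A D ⟩
        signedBinom N′ q * A - signedBinom N′ q * D           ≡⟨ cong (_- signedBinom N′ q * D) equation ⟨
        signedBinom N k * D - signedBinom N′ q * D            ≡⟨ collect (signedBinom N k) (signedBinom N′ q) D ⟩
        (signedBinom N k - signedBinom N′ q) * D              ∎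
        where
        expand : ∀ f A D → f * (A - D) ≡ f * A - f * D
        expand = solve-∀
        collect : ∀ f g D → f * D - g * D ≡ (f - g) * D
        collect = solve-∀

    scaling-congruence : ∀ q s → s ℕ.< p → P ℤD.∣ signedBinom N (s ℕ.+ q ℕ.* p) - signedBinom N′ q
    scaling-congruence q s s<p = factorisation⇒congruence (factorisation q s s<p)

  -- Lucas-type congruence binom(s + c·p, p·A) ≡ binom(c, A) (mod p^(r+1)) for s < p
  -- and p^r ∣ A: the scaling congruence for N′ = -A, where F (-A) k = binom(k+A, A).
  binomial-scaling : ∀ A c s → s ℕ.< p → p ℕ.^ r ℕD.∣ A →
                     P ℤD.∣ + ((s ℕ.+ c ℕ.* p) C (p ℕ.* A)) - + (c C A)
  binomial-scaling A c s s<p p^r∣A with A ℕ.≤? c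
  ... | yes A≤c = subst (P ℤD.∣_) (cong₂ _-_ upper lower)
                    (Scaling.scaling-congruence (- (+ A)) (ℤD.∣m⇒∣-m (ℤD.∣ᵤ⇒∣ p^r∣A)) d s s<p)
    where
    d : ℕ
    d = c ℕ.∸ A
    c≡d+A : c ≡ d ℕ.+ A
    c≡d+A = sym (ℕP.m∸n+n≡m A≤c)
    shift : ∀ s d A p → (s ℕ.+ d ℕ.* p) ℕ.+ p ℕ.* A ≡ s ℕ.+ (d ℕ.+ A) ℕ.* p
    shift = ℕSolver.solve-∀
    upper : signedBinom (+ p * - (+ A)) (s ℕ.+ d ℕ.* p) ≡ + ((s ℕ.+ c ℕ.* p) C (p ℕ.* A))
    upper = begin
      signedBinom (+ p * - (+ A)) (s ℕ.+ d ℕ.* p)               ≡⟨ cong (λ N → signedBinom N (s ℕ.+ d ℕ.* p)) (n*-A≡-nA p A) ⟩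
      signedBinom (- (+ (p ℕ.* A))) (s ℕ.+ d ℕ.* p)             ≡⟨ signedBinom-nonpositive (p ℕ.* A) (s ℕ.+ d ℕ.* p) ⟩
      + ((s ℕ.+ d ℕ.* p ℕ.+ p ℕ.* A) C (s ℕ.+ d ℕ.* p))         ≡⟨ cong +_ (choose-symmetric (s ℕ.+ d ℕ.* p) (p ℕ.* A)) ⟩
      + ((s ℕ.+ d ℕ.* p ℕ.+ p ℕ.* A) C (p ℕ.* A))               ≡⟨ cong (λ n → + (n C (p ℕ.* A))) (trans (shift s d A p) (cong (λ x → s ℕ.+ x ℕ.* p) (sym c≡d+A))) ⟩
      + ((s ℕ.+ c ℕ.* p) C (p ℕ.* A))                           ∎
      where open ≡-Reasoning
    lower : signedBinom (- (+ A)) d ≡ + (c C A)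
    lower = trans (signedBinom-nonpositive A d) (cong +_ (trans (choose-symmetric d A) (cong (_C A) (sym c≡d+A))))
  ... | no A≰c = ≡⇒∣- (cong +_ (trans (k>n⇒nCk≡0 b<pA) (sym (k>n⇒nCk≡0 c<A))))
    where
    c<A : c ℕ.< A
    c<A = ℕP.≰⇒> A≰c
    b<pA : s ℕ.+ c ℕ.* p ℕ.< p ℕ.* A
    b<pA = ℕP.<-≤-trans (ℕP.+-monoˡ-< (c ℕ.* p) s<p)
             (subst (suc c ℕ.* p ℕ.≤_) (ℕP.*-comm A p) (ℕP.*-monoˡ-≤ p c<A))

  negative-floor : ∀ b → Σ ℕ λ c → Σ ℕ λ s →
                   s ℕ.< p × b ≡ s ℕ.+ c ℕ.* p × -[1+ b ] ℤ./ℕ p ≡ -[1+ c ]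
  negative-floor b with suc b ℕ.% p | m≡m%n+[m/n]*n (suc b) p | m%n<n (suc b) p
  ... | zero  | b+1≡qp | _ = exact-multiple (suc b ℕ./ p) b+1≡qp
    where
    exact-multiple : ∀ q → suc b ≡ q ℕ.* p → Σ ℕ λ c → Σ ℕ λ s →
                     s ℕ.< p × b ≡ s ℕ.+ c ℕ.* p × - (+ q) ≡ -[1+ c ]
    exact-multiple zero    ()
    exact-multiple (suc c) b+1≡[c+1]p = c , p₁ , ℕP.≤-refl , ℕP.suc-injective b+1≡[c+1]p , refl
  ... | suc t | b+1≡t+1+qp | t+1<p =
    suc b ℕ./ p , t , ℕP.<-trans (ℕP.n<1+n t) t+1<p , ℕP.suc-injective b+1≡t+1+qp , refl

  -- The case k < 0 for N′ = -A: the two sides are -(-1)^(pA)·binom(s+cp, pA) and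
  -- -(-1)^A·binom(c, A), congruent by the Lucas-type and the sign congruences.
  lower-congruence-nonpositive : ∀ A c s → s ℕ.< p → p ℕ.^ r ℕD.∣ A →
    P ℤD.∣ signedBinom⁻ (+ p * - (+ A)) (s ℕ.+ c ℕ.* p) - signedBinom⁻ (- (+ A)) c
  lower-congruence-nonpositive A c s s<p p^r∣A = subst (P ℤD.∣_) (sym rearranged)
    (ℤD.∣m∣n⇒∣m+n (ℤD.∣n⇒∣m*n σ (ℤD.∣m⇒∣-m (binomial-scaling A c s s<p p^r∣A)))
                  (ℤD.∣m⇒∣m*n Y (sign-congruence r A p-prime p^r∣A)))
    where
    open ≡-Reasoning
    σ σ′ X Y : ℤ
    σ = -1ℤ ^ (p ℕ.* A)
    σ′ = -1ℤ ^ A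
    X = + ((s ℕ.+ c ℕ.* p) C (p ℕ.* A))
    Y = + (c C A)
    split : ∀ σ σ′ X Y → - (σ * X) - - (σ′ * Y) ≡ σ * - (X - Y) + (σ′ - σ) * Y
    split = solve-∀
    rearranged : signedBinom⁻ (+ p * - (+ A)) (s ℕ.+ c ℕ.* p) - signedBinom⁻ (- (+ A)) c ≡ σ * - (X - Y) + (σ′ - σ) * Y
    rearranged = begin
      signedBinom⁻ (+ p * - (+ A)) (s ℕ.+ c ℕ.* p) - signedBinom⁻ (- (+ A)) c
        ≡⟨ cong (λ N → signedBinom⁻ N (s ℕ.+ c ℕ.* p) - signedBinom⁻ (- (+ A)) c) (n*-A≡-nA p A) ⟩
      signedBinom⁻ (- (+ (p ℕ.* A))) (s ℕ.+ c ℕ.* p) - signedBinom⁻ (- (+ A)) c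
        ≡⟨ cong₂ _-_ (signedBinom⁻-nonpositive (p ℕ.* A) (s ℕ.+ c ℕ.* p)) (signedBinom⁻-nonpositive A c) ⟩
      - (σ * X) - - (σ′ * Y)
        ≡⟨ split σ σ′ X Y ⟩
      σ * - (X - Y) + (σ′ - σ) * Y ∎

  -- The case k = -1-(s + c·p) < 0: F⁻ (p·N′) (s + c·p) ≡ F⁻ N′ c for p^r ∣ N′;
  -- for N′ > 0 both sides vanish.
  lower-congruence : ∀ N′ → + (p ℕ.^ r) ℤD.∣ N′ → ∀ c s → s ℕ.< p →
    P ℤD.∣ signedBinom⁻ (+ p * N′) (s ℕ.+ c ℕ.* p) - signedBinom⁻ N′ c
  lower-congruence (+ suc n) _ c s s<p = ≡⇒∣- {a = + 0} refl
  lower-congruence (+ zero)  p^r∣N′ c s s<p = lower-congruence-nonpositive 0 c s s<p (ℤD.∣⇒∣ᵤ p^r∣N′)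
  lower-congruence -[1+ a ]  p^r∣N′ c s s<p = lower-congruence-nonpositive (suc a) c s s<p (ℤD.∣⇒∣ᵤ p^r∣N′)

  N≡p*N′ : ∀ m → + (p ℕ.^ suc r) * m ≡ + p * (+ (p ℕ.^ r) * m)
  N≡p*N′ m = trans (cong (_* m) (ℤP.pos-* p (p ℕ.^ r))) (ℤP.*-assoc (+ p) (+ (p ℕ.^ r)) m)

  p^r∣p^r*m : ∀ m → + (p ℕ.^ r) ℤD.∣ + (p ℕ.^ r) * m
  p^r∣p^r*m m = ℤD.∣m⇒∣m*n m ℤD.∣-refl

  congruence : ∀ m k →
    P ℤD.∣ binomℤ (+ (p ℕ.^ suc r) * m - 1ℤ) k * signℤ k
         - binomℤ (+ (p ℕ.^ r) * m - 1ℤ) (k ℤ./ℕ p) * signℤ (k ℤ./ℕ p)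
  congruence m (+ k) =
    subst₂ (λ N j → P ℤD.∣ signedBinom N j - signedBinom (+ (p ℕ.^ r) * m) (k ℕ./ p))
      (sym (N≡p*N′ m)) (sym (m≡m%n+[m/n]*n k p))
      (Scaling.scaling-congruence (+ (p ℕ.^ r) * m) (p^r∣p^r*m m) (k ℕ./ p) (k ℕ.% p) (m%n<n k p))
  congruence m -[1+ b ] with negative-floor b
  ... | c , s , s<p , refl , floor =
    subst₂ (λ N z → P ℤD.∣ signedBinom⁻ N (s ℕ.+ c ℕ.* p) - binomℤ (+ (p ℕ.^ r) * m - 1ℤ) z * signℤ z)
      (sym (N≡p*N′ m)) (sym floor)
      (lower-congruence (+ (p ℕ.^ r) * m) (p^r∣p^r*m m) c s s<p)

lemma5p4 : (p : ℕ) (pp : Prime p) (m k : ℤ) (r : ℕ) → 1 ℕ.≤ r →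
    binomℤ (+ (p ℕ.^ r) * m - 1ℤ) k * signℤ k
      ≡ binomℤ (+ (p ℕ.^ (r ℕ.∸ 1)) * m - 1ℤ) (floorDiv k p pp) * signℤ (floorDiv k p pp)
      [modℤ + (p ℕ.^ r) ]
lemma5p4 zero     pp m k r       _ = ⊥-elim (¬prime[0] pp)
lemma5p4 (suc p₁) pp m k zero    ()
lemma5p4 (suc p₁) pp m k (suc r) _ = ℤD.∣⇒∣ᵤ (Modulo.congruence p₁ pp r m k)
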